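{- For positive integers $k,\ell$ and real numbers $X,H$ with $4\le H\le X$, \[ \#\{(m,n)\in\mathbb{Z}_{\ge1}^2: X<m^k+n^\ell\le X+H\}\ll HX^{\frac1k+\frac1\ell-1}+H^{\frac1k}+X^{\frac1\ell}, \] where the implicit constant is absolute.
   Formalization: The parameters X and H range over the rationals instead of the real numbers. -}

module Defs where

open import Data.Nat as ℕ using (ℕ; zero; suc)
open import Data.Integer as ℤ using (ℤ; +_; ∣_∣)
open import Data.Rational using (ℚ; _/_; _+_; _*_; _<_; _≤_; 1ℚ; floor)
open import Data.Rational.Properties using (_<?_; _≤?_)
open import Data.List using (List; map; filter; length; cartesianProduct; upTo)
open import Data.Product using (_×_; _,_; proj₁; proj₂)
open import Relation.Nullary.Decidable using (_×-dec_)

toℚ : ℕ → ℚ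
toℚ n = (+ n) / 1

infixr 8 _^ℚ_
_^ℚ_ : ℚ → ℕ → ℚ
q ^ℚ zero = 1ℚ
q ^ℚ suc e = q * (q ^ℚ e)

oneTo : ℕ → List ℕ
oneTo B = map suc (upTo B)

InWindow : ℕ → ℕ → ℚ → ℚ → ℕ × ℕ → Set
InWindow k ℓ X H (m , n) =
  (X < toℚ (m ℕ.^ k ℕ.+ n ℕ.^ ℓ)) × (toℚ (m ℕ.^ k ℕ.+ n ℕ.^ ℓ) ≤ X + H)

inWindow? : ∀ k ℓ X H (p : ℕ × ℕ) → Relation.Nullary.Decidable.Dec (InWindow k ℓ X H p)
inWindow? k ℓ X H (m , n) =
  (X <? toℚ (m ℕ.^ k ℕ.+ n ℕ.^ ℓ)) ×-dec (toℚ (m ℕ.^ k ℕ.+ n ℕ.^ ℓ) ≤? X + H)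

-- #{(m,n) ∈ ℤ≥1² : X < m^k + n^ℓ ≤ X + H}.
-- Any such pair has m ≤ m^k ≤ X + H and n ≤ X + H (k, ℓ ≥ 1), so
-- it suffices to range over 1 ≤ m, n ≤ ⌊X + H⌋.
count : ℕ → ℕ → ℚ → ℚ → ℕ
count k ℓ X H =
  length (filter (inWindow? k ℓ X H)
                 (cartesianProduct (oneTo B) (oneTo B)))
  where B = ∣ floor (X + H) ∣

{-# OPTIONS --safe #-}
module Submission where

-- Let x = ⌊X⌋, h = ⌊X + H⌋ − x, a = ⌊x^(1/k)⌋, b = ⌊x^(1/ℓ)⌋ and c = ⌊h^(1/k)⌋.  For fixed n the
-- admissible m satisfy x − n^ℓ < m^k ≤ x + h − n^ℓ, so the row of n has at most 1 + c points, and
-- at most 1 + e points where, by the mean value theorem, e · k (x − n^ℓ)^((k−1)/k) ≤ h.  Rows with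
-- 2n^ℓ ≤ x thus have e · x ≤ 2h(a + 1).  For x/2 < n^ℓ ≤ x the row spacing (n+1)^ℓ − n^ℓ exceeds
-- x/2b, which bounds e · x by 2h times one plus the decrement of A(n) = ⌊(b^k (x − n^ℓ))^(1/k)⌋, a
-- discrete form of ∫ (x − u^ℓ)^(1/k − 1) du; these decrements telescope to at most b(a + 1).  The
-- rows n ≥ b number at most 2 + h(b + 1)/x.  Altogether count · x ≤ 16hab + 2cx + 3bx, so count is
-- at most a constant times one of hab/x, c and b, and raising to suitable powers removes the roots.

module Arithmetic where

  open import Data.Nat
  open import Data.Nat.Properties
  open import Data.Nat.Tactic.RingSolver using (solve-∀)
  open import Data.Nat.ListAction using (sum)
  open import Data.Nat.ListAction.Properties using (sum-++)
  open import Data.Product using (_×_; _,_; proj₁; proj₂)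
  open import Data.List using (List; []; _∷_; _++_; [_]; map; filter; length; cartesianProduct; upTo)
  open import Data.List.Properties using (map-++; map-∘; applyUpTo-∷ʳ)
  open import Relation.Binary.PropositionalEquality
    using (_≡_; refl; sym; trans; cong; cong₂; subst; module ≡-Reasoning)
  open import Relation.Nullary using (Dec; yes; no; contradiction)
  open import Relation.Nullary.Decidable using (_×-dec_)
  open import Relation.Unary using (Pred; Decidable)
  open import Algebra.Properties.CommutativeSemigroup *-commutativeSemigroup
    using (x∙yz≈xz∙y; x∙yz≈yx∙z; x∙yz≈y∙xz; xy∙z≈xz∙y)
  open import Algebra.Properties.CommutativeSemigroup +-commutativeSemigroup
    using () renaming (interchange to +-interchange)
  open import Defs using (oneTo)

  [m+n]∸o≤[m∸o]+n : ∀ m n o → (m + n) ∸ o ≤ (m ∸ o) + n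
  [m+n]∸o≤[m∸o]+n m n o = m≤n+o⇒m∸n≤o (m + n) o (begin
    m + n             ≤⟨ +-monoˡ-≤ n (m≤n+m∸n m o) ⟩
    o + (m ∸ o) + n   ≡⟨ +-assoc o (m ∸ o) n ⟩
    o + ((m ∸ o) + n) ∎)
    where open ≤-Reasoning

  suc[m]∸n≤suc[m∸n] : ∀ m n → suc m ∸ n ≤ suc (m ∸ n)
  suc[m]∸n≤suc[m∸n] m n = m≤n+o⇒m∸n≤o (suc m) n
    (≤-trans (s≤s (m≤n+m∸n m n)) (≤-reflexive (sym (+-suc n (m ∸ n)))))

  m∸n≤suc[m∸suc[n]] : ∀ m n → m ∸ n ≤ suc (m ∸ suc n)
  m∸n≤suc[m∸suc[n]] m n = m≤n+o⇒m∸n≤o m n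
    (≤-trans (m≤n+m∸n m (suc n)) (≤-reflexive (sym (+-suc n (m ∸ suc n)))))

  [m∸n]∸[m∸o]≡o∸n : ∀ {m n o} → n ≤ o → o ≤ m → (m ∸ n) ∸ (m ∸ o) ≡ o ∸ n
  [m∸n]∸[m∸o]≡o∸n {m} {n} {o} n≤o o≤m = begin
    (m ∸ n) ∸ (m ∸ o)                 ≡⟨ cong (λ z → z ∸ n ∸ (m ∸ o)) (m∸n+n≡m o≤m) ⟨
    ((m ∸ o) + o) ∸ n ∸ (m ∸ o)       ≡⟨ cong (_∸ (m ∸ o)) (+-∸-assoc (m ∸ o) n≤o) ⟩
    (m ∸ o) + (o ∸ n) ∸ (m ∸ o)       ≡⟨ m+n∸m≡n (m ∸ o) (o ∸ n) ⟩
    o ∸ n                             ∎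
    where open ≡-Reasoning

  2*n≤m⇒m≤2*[m∸n] : ∀ {m n} → 2 * n ≤ m → m ≤ 2 * (m ∸ n)
  2*n≤m⇒m≤2*[m∸n] {m} {n} 2n≤m = begin
    m             ≤⟨ m+n≤o⇒m≤o∸n m m+2n≤2m ⟩
    2 * m ∸ 2 * n ≡⟨ *-distribˡ-∸ 2 m n ⟨
    2 * (m ∸ n)   ∎
    where
    open ≤-Reasoning
    m+2n≤2m : m + 2 * n ≤ 2 * m
    m+2n≤2m = ≤-trans (+-monoʳ-≤ m 2n≤m) (≤-reflexive (cong (m +_) (sym (+-identityʳ m))))

  1+n≤2*n : ∀ {n} → 1 ≤ n → suc n ≤ 2 * n
  1+n≤2*n {n} 1≤n = ≤-trans (+-monoˡ-≤ n 1≤n) (≤-reflexive (cong (n +_) (sym (+-identityʳ n))))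

  ^-distribʳ-* : ∀ k m n → (m * n) ^ k ≡ m ^ k * n ^ k
  ^-distribʳ-* zero    m n = refl
  ^-distribʳ-* (suc k) m n = begin
    m * n * (m * n) ^ k     ≡⟨ cong (m * n *_) (^-distribʳ-* k m n) ⟩
    m * n * (m ^ k * n ^ k) ≡⟨ [m*n]*[o*p]≡[m*o]*[n*p] m n (m ^ k) (n ^ k) ⟩
    m * m ^ k * (n * n ^ k) ∎
    where open ≡-Reasoning

  2*m^k≤[2*m]^k : ∀ k m → 2 * m ^ suc k ≤ (2 * m) ^ suc k
  2*m^k≤[2*m]^k k m = begin
    2 * m ^ suc k          ≤⟨ *-monoˡ-≤ (m ^ suc k) (*-monoʳ-≤ 2 (m^n>0 2 k)) ⟩
    2 ^ suc k * m ^ suc k  ≡⟨ ^-distribʳ-* (suc k) 2 m ⟨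
    (2 * m) ^ suc k        ∎
    where open ≤-Reasoning

  ^-superadditive : ∀ k u v → u ^ suc k + v ^ suc k ≤ (u + v) ^ suc k
  ^-superadditive zero    u v = ≤-reflexive (sym (*-distribʳ-+ 1 u v))
  ^-superadditive (suc k) u v = begin
    u * u ^ suc k + v * v ^ suc k
      ≤⟨ +-mono-≤ (*-monoʳ-≤ u (m≤m+n _ (v ^ suc k))) (*-monoʳ-≤ v (m≤n+m _ (u ^ suc k))) ⟩
    u * (u ^ suc k + v ^ suc k) + v * (u ^ suc k + v ^ suc k)
      ≡⟨ *-distribʳ-+ _ u v ⟨
    (u + v) * (u ^ suc k + v ^ suc k)
      ≤⟨ *-monoʳ-≤ (u + v) (^-superadditive k u v) ⟩
    (u + v) * (u + v) ^ suc k ∎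
    where open ≤-Reasoning

  ^-tangent-below : ∀ k q d → q ^ suc k + d * (suc k * q ^ k) ≤ (q + d) ^ suc k
  ^-tangent-below zero    q d = ≤-reflexive (sym (*-distribʳ-+ 1 q d))
  ^-tangent-below (suc k) q d = begin
    q * q ^ suc k + d * (suc (suc k) * q ^ suc k)
      ≤⟨ m≤m+n _ (d * (d * (suc k * q ^ k))) ⟩
    q * q ^ suc k + d * (suc (suc k) * q ^ suc k) + d * (d * (suc k * q ^ k))
      ≡⟨ expand q d (suc k) (q ^ k) ⟩
    (q + d) * (q ^ suc k + d * (suc k * q ^ k))
      ≤⟨ *-monoʳ-≤ (q + d) (^-tangent-below k q d) ⟩
    (q + d) * (q + d) ^ suc k ∎
    where
    open ≤-Reasoning
    expand : ∀ q d K B → q * (q * B) + d * ((1 + K) * (q * B)) + d * (d * (K * B))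
                       ≡ (q + d) * (q * B + d * (K * B))
    expand = solve-∀

  ^-tangent-above : ∀ k q d → (q + d) ^ suc k ≤ q ^ suc k + d * (suc k * (q + d) ^ k)
  ^-tangent-above zero    q d = ≤-reflexive (*-distribʳ-+ 1 q d)
  ^-tangent-above (suc k) q d = begin
    (q + d) * (q + d) ^ suc k
      ≤⟨ *-monoʳ-≤ (q + d) (^-tangent-above k q d) ⟩
    (q + d) * (q ^ suc k + d * (suc k * (q + d) ^ k))
      ≡⟨ expand q d (suc k) (q ^ suc k) ((q + d) ^ k) ⟩
    q * q ^ suc k + d * q ^ suc k + d * (suc k * ((q + d) * (q + d) ^ k))
      ≤⟨ +-monoˡ-≤ _ (+-monoʳ-≤ (q * q ^ suc k) (*-monoʳ-≤ d (^-monoˡ-≤ (suc k) (m≤m+n q d)))) ⟩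
    q * q ^ suc k + d * (q + d) ^ suc k + d * (suc k * (q + d) ^ suc k)
      ≡⟨ collect (q * q ^ suc k) d (suc k) ((q + d) ^ suc k) ⟩
    q * q ^ suc k + d * (suc (suc k) * (q + d) ^ suc k) ∎
    where
    open ≤-Reasoning
    expand : ∀ q d K P E → (q + d) * (P + d * (K * E)) ≡ q * P + d * P + d * (K * ((q + d) * E))
    expand = solve-∀
    collect : ∀ Q d K F → Q + d * F + d * (K * F) ≡ Q + d * ((1 + K) * F)
    collect = solve-∀

  ^-suc-∸-^ : ∀ l n → n ^ l ≤ suc n ^ suc l ∸ n ^ suc l
  ^-suc-∸-^ l n = m+n≤o⇒m≤o∸n (n ^ l) (begin
    n ^ l + n ^ suc l                ≤⟨ +-monoˡ-≤ _ (m≤m+n (n ^ l) (l * n ^ l)) ⟩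
    suc l * n ^ l + n ^ suc l        ≡⟨ +-comm _ (n ^ suc l) ⟩
    n ^ suc l + suc l * n ^ l        ≡⟨ cong (n ^ suc l +_) (*-identityˡ _) ⟨
    n ^ suc l + 1 * (suc l * n ^ l)  ≤⟨ ^-tangent-below l n 1 ⟩
    (n + 1) ^ suc l                  ≡⟨ cong (_^ suc l) (+-comm n 1) ⟩
    suc n ^ suc l                    ∎)
    where open ≤-Reasoning

  -- Integer roots

  -- root k v = ⌊v^(1/(k+1))⌋.  Exponents are written suc k throughout, so that they are positive.
  root : ℕ → ℕ → ℕ
  root k zero    = zero
  root k (suc v) with suc (root k v) ^ suc k ≤? suc v
  ... | yes _ = suc (root k v)
  ... | no  _ = root k v

  root-spec : ∀ k v → root k v ^ suc k ≤ v × v < suc (root k v) ^ suc k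
  root-spec k zero = z≤n , m^n>0 1 (suc k)
  root-spec k (suc v) with suc (root k v) ^ suc k ≤? suc v | root-spec k v
  ... | yes r^≤ | _ , v< = r^≤ , <-≤-trans (s≤s v<) (^-monoˡ-< (suc k) (n<1+n (suc (root k v))))
  ... | no  r^≰ | r^≤ , _ = m≤n⇒m≤1+n r^≤ , ≰⇒> r^≰

  root-^-≤ : ∀ k v → root k v ^ suc k ≤ v
  root-^-≤ k v = proj₁ (root-spec k v)

  <-suc-root-^ : ∀ k v → v < suc (root k v) ^ suc k
  <-suc-root-^ k v = proj₂ (root-spec k v)

  ≤-root : ∀ k {m v} → m ^ suc k ≤ v → m ≤ root k v
  ≤-root k {m} {v} m^≤v = ≮⇒≥ λ root<m →
    <⇒≱ (<-≤-trans (<-suc-root-^ k v) (^-monoˡ-≤ (suc k) root<m)) m^≤v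

  root-< : ∀ k {m v} → v < m ^ suc k → root k v < m
  root-< k {m} {v} v<m^ = ≰⇒> λ m≤root →
    <⇒≱ v<m^ (≤-trans (^-monoˡ-≤ (suc k) m≤root) (root-^-≤ k v))

  root-mono-≤ : ∀ k {u v} → u ≤ v → root k u ≤ root k v
  root-mono-≤ k {u} u≤v = ≤-root k (≤-trans (root-^-≤ k u) u≤v)

  root-*-^ : ∀ k r .{{_ : NonZero r}} t → root k (r ^ suc k * t) < r * suc (root k t)
  root-*-^ k r t = root-< k (begin-strict
    r ^ suc k * t                    <⟨ *-monoʳ-< (r ^ suc k) {{m^n≢0 r (suc k)}} (<-suc-root-^ k t) ⟩
    r ^ suc k * suc (root k t) ^ suc k ≡⟨ ^-distribʳ-* (suc k) r (suc (root k t)) ⟨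
    (r * suc (root k t)) ^ suc k     ∎)
    where open ≤-Reasoning

  ∸-≤-root-tangent : ∀ k {v w} → w ≤ v →
                     v ∸ w ≤ (suc (root k v) ∸ root k w) * (suc k * suc (root k v) ^ k)
  ∸-≤-root-tangent k {v} {w} w≤v = m≤n+o⇒m∸n≤o v w (<⇒≤ (begin-strict
    v                                 <⟨ <-suc-root-^ k v ⟩
    suc u ^ suc k                     ≤⟨ tangent ⟩
    u′ ^ suc k + D * (suc k * suc u ^ k) ≤⟨ +-monoˡ-≤ _ (root-^-≤ k w) ⟩
    w + D * (suc k * suc u ^ k)       ∎))
    where
    open ≤-Reasoning
    u u′ D : ℕ
    u = root k v
    u′ = root k w
    D = suc u ∸ u′
    tangent : suc u ^ suc k ≤ u′ ^ suc k + D * (suc k * suc u ^ k)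
    tangent = subst (λ z → z ^ suc k ≤ u′ ^ suc k + D * (suc k * z ^ k))
                    (m+[n∸m]≡n (m≤n⇒m≤1+n (root-mono-≤ k w≤v)))
                    (^-tangent-above k u′ D)

  root-scaled-∸ : ∀ k r .{{_ : NonZero r}} {s t} → s ≤ t →
                  r * (t ∸ s) ≤ (suc (root k (r ^ suc k * t)) ∸ root k (r ^ suc k * s)) * (suc k * suc (root k t) ^ k)
  root-scaled-∸ k r {s} {t} s≤t = *-cancelˡ-≤ (r ^ k) {{m^n≢0 r k}} (begin
    r ^ k * (r * (t ∸ s))                 ≡⟨ x∙yz≈yx∙z (r ^ k) r (t ∸ s) ⟩
    r ^ suc k * (t ∸ s)                   ≡⟨ *-distribˡ-∸ (r ^ suc k) t s ⟩
    r ^ suc k * t ∸ r ^ suc k * s         ≤⟨ ∸-≤-root-tangent k (*-monoʳ-≤ (r ^ suc k) s≤t) ⟩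
    D * (suc k * suc u ^ k)               ≤⟨ *-monoʳ-≤ D (*-monoʳ-≤ (suc k) (^-monoˡ-≤ k (root-*-^ k r t))) ⟩
    D * (suc k * (r * suc q) ^ k)         ≡⟨ cong (λ z → D * (suc k * z)) (^-distribʳ-* k r (suc q)) ⟩
    D * (suc k * (r ^ k * suc q ^ k))     ≡⟨ rearrange D (suc k) (r ^ k) (suc q ^ k) ⟩
    r ^ k * (D * (suc k * suc q ^ k))     ∎)
    where
    open ≤-Reasoning
    u q D : ℕ
    u = root k (r ^ suc k * t)
    q = root k t
    D = suc u ∸ root k (r ^ suc k * s)
    rearrange : ∀ d K R Q → d * (K * (R * Q)) ≡ R * (d * (K * Q))
    rearrange = solve-∀

  window⇒root-bounds : ∀ k {x y m P} → 0 < m → x < m ^ suc k + P → m ^ suc k + P ≤ y →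
                       suc (root k (x ∸ P)) ≤ m × m ≤ root k (y ∸ P)
  window⇒root-bounds k {x} {y} {m} {P} 0<m x< ≤y =
    root-< k (m<n+o⇒m∸n<o x P {{m^n≢0 m (suc k) {{>-nonZero 0<m}}}} (subst (x <_) (+-comm _ P) x<)) ,
    ≤-root k (m+n≤o⇒m≤o∸n (m ^ suc k) ≤y)

  -- the number of (k+1)-th powers in (t, t + h] beyond the first
  excess : ℕ → ℕ → ℕ → ℕ
  excess k t h = root k (t + h) ∸ suc (root k t)

  root-+-∸-root≤suc-excess : ∀ k t h → root k (t + h) ∸ root k t ≤ suc (excess k t h)
  root-+-∸-root≤suc-excess k t h = m∸n≤suc[m∸suc[n]] (root k (t + h)) (root k t)

  -- Since root k (t + h) ^ (k+1) ≤ t + h < suc (root k t) ^ (k+1) + h, every lower bound f on the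
  -- growth of (k+1)-th powers beyond suc (root k t) satisfies f (excess k t h) ≤ h.
  excess-bound : ∀ k t h (f : ℕ → ℕ) → f 0 ≡ 0 →
                 (∀ d → suc (root k t) ^ suc k + f d ≤ (suc (root k t) + d) ^ suc k) →
                 f (excess k t h) ≤ h
  excess-bound k t h f f0≡0 grows with suc (root k t) ≤? root k (t + h)
  ... | no  q≮p = subst (_≤ h) (sym (trans (cong f (m≤n⇒m∸n≡0 (<⇒≤ (≰⇒> q≮p)))) f0≡0)) z≤n
  ... | yes q<p = <⇒≤ (+-cancelˡ-< (suc q ^ suc k) _ h (begin-strict
    suc q ^ suc k + f e ≤⟨ grows e ⟩
    (suc q + e) ^ suc k ≡⟨ cong (_^ suc k) (m+[n∸m]≡n q<p) ⟩
    p ^ suc k           ≤⟨ root-^-≤ k (t + h) ⟩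
    t + h               <⟨ +-monoˡ-< h (<-suc-root-^ k t) ⟩
    suc q ^ suc k + h   ∎))
    where
    open ≤-Reasoning
    p q e : ℕ
    p = root k (t + h)
    q = root k t
    e = excess k t h

  excess-^-≤ : ∀ k t h → excess k t h ^ suc k ≤ h
  excess-^-≤ k t h = excess-bound k t h (_^ suc k) refl (^-superadditive k (suc (root k t)))

  excess-tangent-≤ : ∀ k t h → excess k t h * (suc k * suc (root k t) ^ k) ≤ h
  excess-tangent-≤ k t h =
    excess-bound k t h (_* (suc k * suc (root k t) ^ k)) refl (^-tangent-below k (suc (root k t)))

  root-+-∸-root≤suc-root : ∀ k t h → root k (t + h) ∸ root k t ≤ suc (root k h)
  root-+-∸-root≤suc-root k t h = ≤-trans (root-+-∸-root≤suc-excess k t h) (s≤s (≤-root k (excess-^-≤ k t h)))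

  excess-*-≤ : ∀ k t h → excess k t h * t ≤ h * suc (root k t)
  excess-*-≤ k t h = begin
    e * t                          ≤⟨ *-monoʳ-≤ e (<⇒≤ (<-suc-root-^ k t)) ⟩
    e * (suc q * suc q ^ k)        ≡⟨ x∙yz≈xz∙y e (suc q) (suc q ^ k) ⟩
    e * suc q ^ k * suc q          ≤⟨ *-monoˡ-≤ (suc q) (*-monoʳ-≤ e (m≤m+n (suc q ^ k) (k * suc q ^ k))) ⟩
    e * (suc k * suc q ^ k) * suc q ≤⟨ *-monoˡ-≤ (suc q) (excess-tangent-≤ k t h) ⟩
    h * suc q                      ∎
    where
    open ≤-Reasoning
    q e : ℕ
    q = root k t
    e = excess k t h

  -- Finite sums

  ∑ : ∀ {A : Set} → List A → (A → ℕ) → ℕ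
  ∑ xs f = sum (map f xs)

  syntax ∑ xs (λ x → e) = ∑[ x ∈ xs ] e

  𝟙 : ∀ {P : Set} → Dec P → ℕ
  𝟙 (yes _) = 1
  𝟙 (no _)  = 0

  𝟙≡1 : ∀ {P : Set} (P? : Dec P) → P → 𝟙 P? ≡ 1
  𝟙≡1 (yes _) _ = refl
  𝟙≡1 (no ¬p) p = contradiction p ¬p

  module _ {A : Set} where

    ∑-++ : ∀ xs ys (f : A → ℕ) → ∑ (xs ++ ys) f ≡ ∑ xs f + ∑ ys f
    ∑-++ xs ys f = trans (cong sum (map-++ f xs ys)) (sum-++ (map f xs) (map f ys))

    ∑-mono-≤ : ∀ xs {f g : A → ℕ} → (∀ x → f x ≤ g x) → ∑ xs f ≤ ∑ xs g
    ∑-mono-≤ []       f≤g = z≤n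
    ∑-mono-≤ (x ∷ xs) f≤g = +-mono-≤ (f≤g x) (∑-mono-≤ xs f≤g)

    ∑-+ : ∀ xs (f g : A → ℕ) → ∑[ x ∈ xs ] (f x + g x) ≡ ∑ xs f + ∑ xs g
    ∑-+ []       f g = refl
    ∑-+ (x ∷ xs) f g = trans (cong (f x + g x +_) (∑-+ xs f g)) (+-interchange (f x) (g x) _ _)

    ∑-*ˡ : ∀ xs c (f : A → ℕ) → ∑[ x ∈ xs ] (c * f x) ≡ c * ∑ xs f
    ∑-*ˡ []       c f = sym (*-zeroʳ c)
    ∑-*ˡ (x ∷ xs) c f = trans (cong (c * f x +_) (∑-*ˡ xs c f)) (sym (*-distribˡ-+ c (f x) _))

    ∑-*ʳ : ∀ xs (f : A → ℕ) c → ∑[ x ∈ xs ] (f x * c) ≡ ∑ xs f * c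
    ∑-*ʳ []       f c = refl
    ∑-*ʳ (x ∷ xs) f c = trans (cong (f x * c +_) (∑-*ʳ xs f c)) (sym (*-distribʳ-+ c (f x) _))

    length-filter≡∑𝟙 : ∀ {P : Pred A _} (P? : Decidable P) xs →
                       length (filter P? xs) ≡ ∑[ x ∈ xs ] 𝟙 (P? x)
    length-filter≡∑𝟙 P? []       = refl
    length-filter≡∑𝟙 P? (x ∷ xs) with P? x
    ... | yes _ = cong suc (length-filter≡∑𝟙 P? xs)
    ... | no  _ = length-filter≡∑𝟙 P? xs

  module _ {A B : Set} where

    ∑-comm : ∀ (xs : List A) (ys : List B) (f : A → B → ℕ) →
             ∑[ x ∈ xs ] ∑[ y ∈ ys ] f x y ≡ ∑[ y ∈ ys ] ∑[ x ∈ xs ] f x y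
    ∑-comm []       ys f = sym (∑-zero ys)
      where
      ∑-zero : ∀ (ys : List B) → ∑[ y ∈ ys ] 0 ≡ 0
      ∑-zero []       = refl
      ∑-zero (y ∷ ys) = ∑-zero ys
    ∑-comm (x ∷ xs) ys f = trans (cong (∑ ys (f x) +_) (∑-comm xs ys f)) (sym (∑-+ ys (f x) _))

    ∑-cartesianProduct : ∀ (xs : List A) (ys : List B) (f : A × B → ℕ) →
                         ∑ (cartesianProduct xs ys) f ≡ ∑[ x ∈ xs ] ∑[ y ∈ ys ] f (x , y)
    ∑-cartesianProduct []       ys f = refl
    ∑-cartesianProduct (x ∷ xs) ys f = begin
      ∑ (map (x ,_) ys ++ cartesianProduct xs ys) f
        ≡⟨ ∑-++ (map (x ,_) ys) _ f ⟩
      ∑ (map (x ,_) ys) f + ∑ (cartesianProduct xs ys) f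
        ≡⟨ cong₂ _+_ (cong sum (sym (map-∘ ys))) (∑-cartesianProduct xs ys f) ⟩
      ∑[ y ∈ ys ] f (x , y) + ∑[ x ∈ xs ] ∑[ y ∈ ys ] f (x , y) ∎
      where open ≡-Reasoning

  length-filter-cartesianProduct : ∀ {A B : Set} {P : Pred (A × B) _} (P? : Decidable P) xs ys →
    length (filter P? (cartesianProduct xs ys)) ≡ ∑[ y ∈ ys ] ∑[ x ∈ xs ] 𝟙 (P? (x , y))
  length-filter-cartesianProduct P? xs ys =
    trans (length-filter≡∑𝟙 P? (cartesianProduct xs ys))
          (trans (∑-cartesianProduct xs ys (λ p → 𝟙 (P? p))) (∑-comm xs ys (λ x y → 𝟙 (P? (x , y)))))

  oneTo-suc : ∀ y → oneTo (suc y) ≡ oneTo y ++ [ suc y ]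
  oneTo-suc y = trans (cong (map suc) (sym (applyUpTo-∷ʳ (λ i → i) y))) (map-++ suc (upTo y) [ y ])

  ∑-oneTo-suc : ∀ y (f : ℕ → ℕ) → ∑ (oneTo (suc y)) f ≡ ∑ (oneTo y) f + f (suc y)
  ∑-oneTo-suc y f = begin
    ∑ (oneTo (suc y)) f            ≡⟨ cong (λ xs → ∑ xs f) (oneTo-suc y) ⟩
    ∑ (oneTo y ++ [ suc y ]) f     ≡⟨ ∑-++ (oneTo y) [ suc y ] f ⟩
    ∑ (oneTo y) f + (f (suc y) + 0) ≡⟨ cong (∑ (oneTo y) f +_) (+-identityʳ (f (suc y))) ⟩
    ∑ (oneTo y) f + f (suc y)      ∎
    where open ≡-Reasoning

  ∑𝟙-oneTo-≤ : ∀ {P : Pred ℕ _} (P? : Decidable P) {lo hi} →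
               (∀ {m} → 0 < m → P m → lo ≤ m × m ≤ hi) →
               ∀ y → ∑[ m ∈ oneTo y ] 𝟙 (P? m) ≤ suc hi ∸ lo
  ∑𝟙-oneTo-≤ {P} P? {lo} {hi} P⇒lo≤m≤hi y = proj₂ (bounds y)
    where
    S : ℕ → ℕ
    S y = ∑[ m ∈ oneTo y ] 𝟙 (P? m)
    step : ∀ {y} (d : Dec (P (suc y))) → S y ≤ suc y ∸ lo → S y ≤ suc hi ∸ lo →
           S y + 𝟙 d ≤ suc (suc y) ∸ lo × S y + 𝟙 d ≤ suc hi ∸ lo
    step {y} (no _) ≤y ≤hi rewrite +-identityʳ (S y) = ≤-trans ≤y (∸-monoˡ-≤ lo (n≤1+n (suc y))) , ≤hi
    step {y} (yes p) ≤y _ = ≤′ , ≤-trans ≤′ (∸-monoˡ-≤ lo (s≤s sy≤hi))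
      where
      lo≤sy : lo ≤ suc y
      lo≤sy = proj₁ (P⇒lo≤m≤hi z<s p)
      sy≤hi : suc y ≤ hi
      sy≤hi = proj₂ (P⇒lo≤m≤hi z<s p)
      ≤′ : S y + 1 ≤ suc (suc y) ∸ lo
      ≤′ = begin
        S y + 1              ≤⟨ +-monoˡ-≤ 1 ≤y ⟩
        suc y ∸ lo + 1       ≡⟨ +-∸-comm 1 lo≤sy ⟨
        suc y + 1 ∸ lo       ≡⟨ cong (_∸ lo) (+-comm (suc y) 1) ⟩
        suc (suc y) ∸ lo     ∎
        where open ≤-Reasoning
    bounds : ∀ y → S y ≤ suc y ∸ lo × S y ≤ suc hi ∸ lo
    bounds zero    = z≤n , z≤n
    bounds (suc y) = subst (λ s → s ≤ suc (suc y) ∸ lo × s ≤ suc hi ∸ lo)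
                           (sym (∑-oneTo-suc y (λ m → 𝟙 (P? m))))
                           (step (P? (suc y)) (proj₁ (bounds y)) (proj₂ (bounds y)))

  ∑-telescope : ∀ (A : ℕ → ℕ) → (∀ n → A (suc n) ≤ A n) →
                ∀ y → ∑[ n ∈ oneTo y ] (A n ∸ A (suc n)) + A (suc y) ≡ A 1
  ∑-telescope A antitone zero    = refl
  ∑-telescope A antitone (suc y) = begin
    ∑ (oneTo (suc y)) Δ + A (suc (suc y))         ≡⟨ cong (_+ A (suc (suc y))) (∑-oneTo-suc y Δ) ⟩
    ∑ (oneTo y) Δ + Δ (suc y) + A (suc (suc y))   ≡⟨ +-assoc (∑ (oneTo y) Δ) _ _ ⟩
    ∑ (oneTo y) Δ + (Δ (suc y) + A (suc (suc y))) ≡⟨ cong (∑ (oneTo y) Δ +_) (m∸n+n≡m (antitone (suc y))) ⟩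
    ∑ (oneTo y) Δ + A (suc y)                     ≡⟨ ∑-telescope A antitone y ⟩
    A 1                                           ∎
    where
    open ≡-Reasoning
    Δ : ℕ → ℕ
    Δ n = A n ∸ A (suc n)

  -- Counting row by row

  rowSum-arithmetic : ∀ {x h a b c e} → 1 ≤ a → 1 ≤ b → suc c ≤ 2 * suc a → e * x ≤ h * suc b →
    b * (x + 2 * h * suc a) + 2 * h * (b * suc a) + (2 + e) * (suc c * x)
      ≤ 16 * (h * (a * b)) + 2 * (c * x) + 3 * (b * x)
  rowSum-arithmetic {x} {h} {a} {b} {c} {e} 1≤a 1≤b sc≤2sa ex≤ = begin
    b * (x + 2 * h * suc a) + 2 * h * (b * suc a) + (2 + e) * (suc c * x)
      ≡⟨ expand x h a b c e ⟩
    b * x + 4 * (h * (b * suc a)) + 2 * x + 2 * (c * x) + suc c * (e * x)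
      ≤⟨ +-monoʳ-≤ (b * x + 4 * (h * (b * suc a)) + 2 * x + 2 * (c * x)) (*-mono-≤ sc≤2sa ex≤) ⟩
    b * x + 4 * (h * (b * suc a)) + 2 * x + 2 * (c * x) + 2 * suc a * (h * suc b)
      ≤⟨ +-mono-≤ (+-monoˡ-≤ (2 * (c * x))
                    (+-mono-≤ (+-monoʳ-≤ (b * x) (*-monoʳ-≤ 4 (*-monoʳ-≤ h (*-monoʳ-≤ b sa≤2a))))
                              (*-monoʳ-≤ 2 (m≤n*m x b {{>-nonZero 1≤b}}))))
                  (*-mono-≤ (*-monoʳ-≤ 2 sa≤2a) (*-monoʳ-≤ h sb≤2b)) ⟩
    b * x + 4 * (h * (b * (2 * a))) + 2 * (b * x) + 2 * (c * x) + 2 * (2 * a) * (h * (2 * b))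
      ≡⟨ collect x h a b c ⟩
    16 * (h * (a * b)) + 2 * (c * x) + 3 * (b * x) ∎
    where
    open ≤-Reasoning
    sa≤2a : suc a ≤ 2 * a
    sa≤2a = 1+n≤2*n 1≤a
    sb≤2b : suc b ≤ 2 * b
    sb≤2b = 1+n≤2*n 1≤b
    expand : ∀ x h a b c e → b * (x + 2 * h * suc a) + 2 * h * (b * suc a) + (2 + e) * (suc c * x)
                           ≡ b * x + 4 * (h * (b * suc a)) + 2 * x + 2 * (c * x) + suc c * (e * x)
    expand = solve-∀
    collect : ∀ x h a b c → b * x + 4 * (h * (b * (2 * a))) + 2 * (b * x) + 2 * (c * x) + 2 * (2 * a) * (h * (2 * b))
                          ≡ 16 * (h * (a * b)) + 2 * (c * x) + 3 * (b * x)
    collect = solve-∀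

  module RowCounts (k l x h : ℕ) where

    y a b c : ℕ
    y = x + h
    a = root k x
    b = root l x
    c = root k h

    -- the number of m ≥ 1 with x < m^(k+1) + n^(l+1) ≤ y
    rowCount : ℕ → ℕ
    rowCount n = root k (y ∸ n ^ suc l) ∸ root k (x ∸ n ^ suc l)

    -- A n ≈ b (x − n^(l+1))^(1/(k+1)).  Each decrement Δ n pays for the excess of one row at a
    -- rounding cost of 1; the factor b makes these costs, summed over b rows, small against A 1 ≈ ab.
    A : ℕ → ℕ
    A n = root k (b ^ suc k * (x ∸ n ^ suc l))

    Δ : ℕ → ℕ
    Δ n = A n ∸ A (suc n)

    A-antitone : ∀ n → A (suc n) ≤ A n
    A-antitone n = root-mono-≤ k (*-monoʳ-≤ (b ^ suc k) (∸-monoʳ-≤ x (^-monoˡ-≤ (suc l) (n≤1+n n))))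

    A1≤b*suc[a] : A 1 ≤ b * suc a
    A1≤b*suc[a] = ≤-trans (A-antitone 0) (scaled b)
      where
      scaled : ∀ r → root k (r ^ suc k * x) ≤ r * suc a
      scaled zero      = z≤n
      scaled r@(suc _) = <⇒≤ (root-*-^ k r x)

    rowCount≤window : ∀ n → rowCount n ≤ root k (x ∸ n ^ suc l + h) ∸ root k (x ∸ n ^ suc l)
    rowCount≤window n = ∸-monoˡ-≤ (root k (x ∸ n ^ suc l)) (root-mono-≤ k ([m+n]∸o≤[m∸o]+n x h (n ^ suc l)))

    rowCount≤suc[c] : ∀ n → rowCount n ≤ suc c
    rowCount≤suc[c] n = ≤-trans (rowCount≤window n) (root-+-∸-root≤suc-root k (x ∸ n ^ suc l) h)

    rowCount≡0 : ∀ {n} → root l y < n → rowCount n ≡ 0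
    rowCount≡0 {n} r<n = trans (cong (λ z → root k z ∸ root k (x ∸ n ^ suc l)) (m≤n⇒m∸n≡0 (<⇒≤ y<n^)))
                               (0∸n≡0 (root k (x ∸ n ^ suc l)))
      where
      y<n^ : y < n ^ suc l
      y<n^ = ≰⇒> λ n^≤y → <⇒≱ r<n (≤-root l n^≤y)

    excess*x-low : ∀ {n} → 2 * n ^ suc l ≤ x → excess k (x ∸ n ^ suc l) h * x ≤ 2 * h * suc a
    excess*x-low {n} 2P≤x = begin
      e * x           ≤⟨ *-monoʳ-≤ e (2*n≤m⇒m≤2*[m∸n] {n = n ^ suc l} 2P≤x) ⟩
      e * (2 * t)     ≡⟨ x∙yz≈y∙xz e 2 t ⟩
      2 * (e * t)     ≤⟨ *-monoʳ-≤ 2 (excess-*-≤ k t h) ⟩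
      2 * (h * suc q) ≤⟨ *-monoʳ-≤ 2 (*-monoʳ-≤ h (s≤s (root-mono-≤ k (m∸n≤m x (n ^ suc l))))) ⟩
      2 * (h * suc a) ≡⟨ *-assoc 2 h (suc a) ⟨
      2 * h * suc a   ∎
      where
      open ≤-Reasoning
      t q e : ℕ
      t = x ∸ n ^ suc l
      q = root k t
      e = excess k t h

    -- The rows are spaced by (n+1)^(l+1) − n^(l+1) ≥ n^l > x/2b, and root-scaled-∸ turns this
    -- spacing into the decrement of A.
    excess*x-high : ∀ {n} → n < b → x < 2 * n ^ suc l → excess k (x ∸ n ^ suc l) h * x ≤ 2 * h * suc (Δ n)
    excess*x-high {n} n<b x<2P = begin
      e * x                         ≤⟨ *-monoʳ-≤ e (<⇒≤ x<2b[t∸t′]) ⟩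
      e * (2 * (b * (t ∸ t′)))      ≤⟨ *-monoʳ-≤ e (*-monoʳ-≤ 2 (root-scaled-∸ k b {{b≢0}} t′≤t)) ⟩
      e * (2 * (D * T))             ≡⟨ rearrange e D T ⟩
      2 * D * (e * T)               ≤⟨ *-monoʳ-≤ (2 * D) (excess-tangent-≤ k t h) ⟩
      2 * D * h                     ≡⟨ xy∙z≈xz∙y 2 D h ⟩
      2 * h * D                     ≡⟨ cong (2 * h *_) (+-∸-assoc 1 (A-antitone n)) ⟩
      2 * h * suc (Δ n)             ∎
      where
      open ≤-Reasoning
      P P′ t t′ e D T : ℕ
      P = n ^ suc l
      P′ = suc n ^ suc l
      t = x ∸ P
      t′ = x ∸ P′
      e = excess k t h
      D = suc (A n) ∸ A (suc n)
      T = suc k * suc (root k t) ^ k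
      b≢0 : NonZero b
      b≢0 = >-nonZero (≤-<-trans z≤n n<b)
      P≤P′ : P ≤ P′
      P≤P′ = ^-monoˡ-≤ (suc l) (n≤1+n n)
      P′≤x : P′ ≤ x
      P′≤x = ≤-trans (^-monoˡ-≤ (suc l) n<b) (root-^-≤ l x)
      t′≤t : t′ ≤ t
      t′≤t = ∸-monoʳ-≤ x P≤P′
      x<2b[t∸t′] : x < 2 * (b * (t ∸ t′))
      x<2b[t∸t′] = begin-strict
        x                      <⟨ x<2P ⟩
        2 * (n * n ^ l)        ≤⟨ *-monoʳ-≤ 2 (*-mono-≤ (<⇒≤ n<b) (^-suc-∸-^ l n)) ⟩
        2 * (b * (P′ ∸ P))     ≡⟨ cong (λ z → 2 * (b * z)) ([m∸n]∸[m∸o]≡o∸n P≤P′ P′≤x) ⟨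
        2 * (b * (t ∸ t′))     ∎
      rearrange : ∀ e D T → e * (2 * (D * T)) ≡ 2 * D * (e * T)
      rearrange = solve-∀

    rowCount*x-below : ∀ {n} → n < b → rowCount n * x ≤ x + 2 * h * (suc a + Δ n)
    rowCount*x-below {n} n<b = begin
      rowCount n * x            ≤⟨ *-monoˡ-≤ x (≤-trans (rowCount≤window n) (root-+-∸-root≤suc-excess k t h)) ⟩
      x + e * x                 ≤⟨ +-monoʳ-≤ x e*x≤ ⟩
      x + 2 * h * (suc a + Δ n) ∎
      where
      open ≤-Reasoning
      t e : ℕ
      t = x ∸ n ^ suc l
      e = excess k t h
      e*x≤ : e * x ≤ 2 * h * (suc a + Δ n)
      e*x≤ with 2 * n ^ suc l ≤? x
      ... | yes 2P≤x = ≤-trans (excess*x-low {n} 2P≤x) (*-monoʳ-≤ (2 * h) (m≤m+n (suc a) (Δ n)))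
      ... | no  2P≰x = ≤-trans (excess*x-high n<b (≰⇒> 2P≰x)) (*-monoʳ-≤ (2 * h) (s≤s (m≤n+m (Δ n) a)))

    below? : ∀ n → Dec (n ≤ b)
    below? n = n ≤? b

    beyond? : ∀ n → Dec (b ≤ n × n ≤ root l y)
    beyond? n = b ≤? n ×-dec n ≤? root l y

    rowBound : ℕ → ℕ
    rowBound n = 𝟙 (below? n) * (x + 2 * h * suc a) + 2 * h * Δ n + 𝟙 (beyond? n) * (suc c * x)

    rowCount*x≤ : ∀ n → rowCount n * x ≤ rowBound n
    rowCount*x≤ n with n <? b
    ... | yes n<b = begin
      rowCount n * x                                   ≤⟨ rowCount*x-below n<b ⟩
      x + 2 * h * (suc a + Δ n)                        ≡⟨ regroup x (2 * h) (suc a) (Δ n) ⟩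
      1 * (x + 2 * h * suc a) + 2 * h * Δ n            ≡⟨ cong (λ i → i * _ + 2 * h * Δ n) below≡1 ⟨
      𝟙 (below? n) * (x + 2 * h * suc a) + 2 * h * Δ n ≤⟨ m≤m+n _ _ ⟩
      rowBound n                                       ∎
      where
      open ≤-Reasoning
      below≡1 : 𝟙 (below? n) ≡ 1
      below≡1 = 𝟙≡1 (below? n) (<⇒≤ n<b)
      regroup : ∀ p q r s → p + q * (r + s) ≡ 1 * (p + q * r) + q * s
      regroup = solve-∀
    ... | no n≮b with root l y <? n
    ...   | yes r<n = ≤-trans (≤-reflexive (cong (_* x) (rowCount≡0 r<n))) z≤n
    ...   | no  r≮n = begin
      rowCount n * x              ≤⟨ *-monoˡ-≤ x (rowCount≤suc[c] n) ⟩
      suc c * x                   ≡⟨ *-identityˡ (suc c * x) ⟨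
      1 * (suc c * x)             ≡⟨ cong (_* (suc c * x)) beyond≡1 ⟨
      𝟙 (beyond? n) * (suc c * x) ≤⟨ m≤n+m _ _ ⟩
      rowBound n                  ∎
      where
      open ≤-Reasoning
      beyond≡1 : 𝟙 (beyond? n) ≡ 1
      beyond≡1 = 𝟙≡1 (beyond? n) (≮⇒≥ n≮b , ≮⇒≥ r≮n)

    ∑rowCount*x≤ : (∑[ n ∈ oneTo y ] rowCount n) * x
                   ≤ b * (x + 2 * h * suc a) + 2 * h * (b * suc a) + (suc (root l y) ∸ b) * (suc c * x)
    ∑rowCount*x≤ = begin
      (∑[ n ∈ oneTo y ] rowCount n) * x
        ≡⟨ ∑-*ʳ (oneTo y) rowCount x ⟨
      ∑[ n ∈ oneTo y ] (rowCount n * x)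
        ≤⟨ ∑-mono-≤ (oneTo y) rowCount*x≤ ⟩
      ∑ (oneTo y) rowBound
        ≡⟨ ∑-+ (oneTo y) (λ n → 𝟙 (below? n) * K₁ + 2 * h * Δ n) (λ n → 𝟙 (beyond? n) * K₂) ⟩
      ∑[ n ∈ oneTo y ] (𝟙 (below? n) * K₁ + 2 * h * Δ n) + ∑[ n ∈ oneTo y ] (𝟙 (beyond? n) * K₂)
        ≡⟨ cong₂ _+_ (trans (∑-+ (oneTo y) (λ n → 𝟙 (below? n) * K₁) (λ n → 2 * h * Δ n))
                            (cong₂ _+_ (∑-*ʳ (oneTo y) (λ n → 𝟙 (below? n)) K₁) (∑-*ˡ (oneTo y) (2 * h) Δ)))
                     (∑-*ʳ (oneTo y) (λ n → 𝟙 (beyond? n)) K₂) ⟩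
      (∑[ n ∈ oneTo y ] 𝟙 (below? n)) * K₁ + 2 * h * ∑ (oneTo y) Δ + (∑[ n ∈ oneTo y ] 𝟙 (beyond? n)) * K₂
        ≤⟨ +-mono-≤ (+-mono-≤ (*-monoˡ-≤ K₁ (∑𝟙-oneTo-≤ below? (λ 0<m m≤b → 0<m , m≤b) y))
                              (*-monoʳ-≤ (2 * h) (≤-trans ∑Δ≤A1 A1≤b*suc[a])))
                    (*-monoˡ-≤ K₂ (∑𝟙-oneTo-≤ beyond? (λ _ b≤m≤r → b≤m≤r) y)) ⟩
      b * K₁ + 2 * h * (b * suc a) + (suc (root l y) ∸ b) * K₂ ∎
      where
      open ≤-Reasoning
      K₁ K₂ : ℕ
      K₁ = x + 2 * h * suc a
      K₂ = suc c * x
      ∑Δ≤A1 : ∑ (oneTo y) Δ ≤ A 1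
      ∑Δ≤A1 = subst (∑ (oneTo y) Δ ≤_) (∑-telescope A A-antitone y) (m≤m+n _ (A (suc y)))

    rowSum-bound : 1 ≤ x → h ≤ 2 * x →
                   (∑[ n ∈ oneTo y ] rowCount n) * x ≤ 16 * (h * (a * b)) + 2 * (c * x) + 3 * (b * x)
    rowSum-bound 1≤x h≤2x = begin
      (∑[ n ∈ oneTo y ] rowCount n) * x
        ≤⟨ ∑rowCount*x≤ ⟩
      b * (x + 2 * h * suc a) + 2 * h * (b * suc a) + (suc (root l y) ∸ b) * (suc c * x)
        ≤⟨ +-monoʳ-≤ (b * (x + 2 * h * suc a) + 2 * h * (b * suc a)) (*-monoˡ-≤ (suc c * x) beyondRows≤) ⟩
      b * (x + 2 * h * suc a) + 2 * h * (b * suc a) + (2 + excess l x h) * (suc c * x)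
        ≤⟨ rowSum-arithmetic {x} {h} {e = excess l x h} (1≤root k) (1≤root l) suc[c]≤2*suc[a] (excess-*-≤ l x h) ⟩
      16 * (h * (a * b)) + 2 * (c * x) + 3 * (b * x) ∎
      where
      open ≤-Reasoning
      1≤root : ∀ j → 1 ≤ root j x
      1≤root j = ≤-root j (subst (_≤ x) (sym (^-zeroˡ (suc j))) 1≤x)
      beyondRows≤ : suc (root l y) ∸ b ≤ 2 + excess l x h
      beyondRows≤ = ≤-trans (suc[m]∸n≤suc[m∸n] (root l y) b) (s≤s (root-+-∸-root≤suc-excess l x h))
      suc[c]≤2*suc[a] : suc c ≤ 2 * suc a
      suc[c]≤2*suc[a] = root-< k (begin-strict
        h                        ≤⟨ h≤2x ⟩
        2 * x                    <⟨ *-monoʳ-< 2 (<-suc-root-^ k x) ⟩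
        2 * suc a ^ suc k        ≤⟨ 2*m^k≤[2*m]^k k (suc a) ⟩
        (2 * suc a) ^ suc k      ∎)

module Discretisation where

  open import Data.Nat
  open import Data.Nat.Properties
  open import Data.Nat.DivMod using (_/_; _%_; m/n*n≤m; m≡m%n+[m/n]*n; m%n<n)
  open import Data.Nat.Coprimality as Coprime using ()
  open import Data.Nat.Tactic.RingSolver using (solve-∀)
  open import Data.Integer as ℤ using (+_; -[1+_])
  import Data.Integer.Properties as ℤ
  import Data.Integer.DivMod as ℤ
  open import Data.Rational as ℚ using (ℚ; mkℚ; 0ℚ; floor; *≤*; *<*)
  import Data.Rational.Properties as ℚ
  open import Data.Product using (_×_; _,_; proj₁; proj₂)
  open import Data.Sum using (_⊎_; inj₁; inj₂)
  open import Relation.Binary.PropositionalEquality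
    using (_≡_; refl; sym; trans; cong; cong₂; subst; subst₂; module ≡-Reasoning)
  open import Algebra.Properties.CommutativeSemigroup *-commutativeSemigroup using (x∙yz≈yx∙z; x∙yz≈y∙xz)
  open import Defs
  open Arithmetic

  ≤-+-+⇒≤3* : ∀ {z} u v w → z ≤ u + v + w → z ≤ 3 * u ⊎ z ≤ 3 * v ⊎ z ≤ 3 * w
  ≤-+-+⇒≤3* {z} u v w z≤u+v+w = pick (⊔-sel (u ⊔ v) w) (⊔-sel u v)
    where
    M : ℕ
    M = u ⊔ v ⊔ w
    ≤3*max : ∀ {m} → M ≡ m → z ≤ 3 * m
    ≤3*max refl = ≤-trans z≤u+v+w (begin
      u + v + w  ≤⟨ +-mono-≤ (+-mono-≤ (≤-trans (m≤m⊔n u v) (m≤m⊔n (u ⊔ v) w))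
                                       (≤-trans (m≤n⊔m u v) (m≤m⊔n (u ⊔ v) w)))
                             (m≤n⊔m (u ⊔ v) w) ⟩
      M + M + M  ≡⟨ thrice M ⟩
      3 * M      ∎)
      where
      open ≤-Reasoning
      thrice : ∀ m → m + m + m ≡ 3 * m
      thrice = solve-∀
    pick : M ≡ u ⊔ v ⊎ M ≡ w → u ⊔ v ≡ u ⊎ u ⊔ v ≡ v → z ≤ 3 * u ⊎ z ≤ 3 * v ⊎ z ≤ 3 * w
    pick (inj₂ M≡w)  _           = inj₂ (inj₂ (≤3*max M≡w))
    pick (inj₁ M≡uv) (inj₁ uv≡u) = inj₁ (≤3*max (trans M≡uv uv≡u))
    pick (inj₁ M≡uv) (inj₂ uv≡v) = inj₂ (inj₁ (≤3*max (trans M≡uv uv≡v)))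

  ^-≤-^-* : ∀ {N} C r {z} e → N ≤ C * r → r ^ e ≤ z → N ^ e ≤ C ^ e * z
  ^-≤-^-* {N} C r {z} e N≤Cr r^e≤z = begin
    N ^ e          ≤⟨ ^-monoˡ-≤ e N≤Cr ⟩
    (C * r) ^ e    ≡⟨ ^-distribʳ-* e C r ⟩
    C ^ e * r ^ e  ≤⟨ *-monoʳ-≤ (C ^ e) r^e≤z ⟩
    C ^ e * z      ∎
    where open ≤-Reasoning

  ^-*-^-≤ : ∀ N w C m a b {x} K L → N * w ≤ C * m * (a * b) → a ^ K ≤ x → b ^ L ≤ x →
            N ^ (K * L) * w ^ (K * L) ≤ (C * m) ^ (K * L) * x ^ (K + L)
  ^-*-^-≤ N w C m a b {x} K L Nw≤ a^K≤x b^L≤x = begin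
    N ^ e * w ^ e
      ≡⟨ ^-distribʳ-* e N w ⟨
    (N * w) ^ e
      ≤⟨ ^-monoˡ-≤ e Nw≤ ⟩
    (C * m * (a * b)) ^ e
      ≡⟨ trans (^-distribʳ-* e (C * m) (a * b)) (cong ((C * m) ^ e *_) (^-distribʳ-* e a b)) ⟩
    (C * m) ^ e * (a ^ e * b ^ e)
      ≤⟨ *-monoʳ-≤ ((C * m) ^ e) (*-mono-≤ a^e≤ b^e≤) ⟩
    (C * m) ^ e * (x ^ L * x ^ K)
      ≡⟨ cong ((C * m) ^ e *_) (trans (*-comm (x ^ L) (x ^ K)) (sym (^-distribˡ-+-* x K L))) ⟩
    (C * m) ^ e * x ^ (K + L) ∎
    where
    open ≤-Reasoning
    e : ℕ
    e = K * L
    a^e≤ : a ^ e ≤ x ^ L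
    a^e≤ = ≤-trans (≤-reflexive (sym (^-*-assoc a K L))) (^-monoˡ-≤ L a^K≤x)
    b^e≤ : b ^ e ≤ x ^ K
    b^e≤ = ≤-trans (≤-reflexive (trans (cong (b ^_) (*-comm K L)) (sym (^-*-assoc b L K)))) (^-monoˡ-≤ K b^L≤x)

  -- The embedding of ℕ into ℚ

  toℚ≡mkℚ : ∀ n → toℚ n ≡ mkℚ (+ n) 0 (Coprime.sym (Coprime.1-coprimeTo n))
  toℚ≡mkℚ n = ℚ.normalize-coprime _

  toℚ-+ : ∀ m n → toℚ (m + n) ≡ toℚ m ℚ.+ toℚ n
  toℚ-+ m n rewrite toℚ≡mkℚ m | toℚ≡mkℚ n =
    cong (ℚ._/ 1) (trans (ℤ.pos-+ m n) (sym (cong₂ ℤ._+_ (ℤ.*-identityʳ (+ m)) (ℤ.*-identityʳ (+ n)))))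

  toℚ-* : ∀ m n → toℚ (m * n) ≡ toℚ m ℚ.* toℚ n
  toℚ-* m n rewrite toℚ≡mkℚ m | toℚ≡mkℚ n = cong (ℚ._/ 1) (ℤ.pos-* m n)

  toℚ-^ : ∀ m e → toℚ (m ^ e) ≡ toℚ m ^ℚ e
  toℚ-^ m zero    = refl
  toℚ-^ m (suc e) = trans (toℚ-* m (m ^ e)) (cong (toℚ m ℚ.*_) (toℚ-^ m e))

  toℚ-mono-≤ : ∀ {m n} → m ≤ n → toℚ m ℚ.≤ toℚ n
  toℚ-mono-≤ {m} {n} m≤n rewrite toℚ≡mkℚ m | toℚ≡mkℚ n =
    *≤* (subst₂ ℤ._≤_ (sym (ℤ.*-identityʳ (+ m))) (sym (ℤ.*-identityʳ (+ n))) (ℤ.+≤+ m≤n))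

  toℚ-cancel-< : ∀ {m n} → toℚ m ℚ.< toℚ n → m < n
  toℚ-cancel-< {m} {n} m<n rewrite toℚ≡mkℚ m | toℚ≡mkℚ n with m<n
  ... | *<* m*1<n*1 = ℤ.drop‿+<+ (subst₂ ℤ._<_ (ℤ.*-identityʳ (+ m)) (ℤ.*-identityʳ (+ n)) m*1<n*1)

  toℚ-nonNeg : ∀ n → 0ℚ ℚ.≤ toℚ n
  toℚ-nonNeg n = toℚ-mono-≤ {0} {n} z≤n

  floor-spec : ∀ p → 0ℚ ℚ.≤ p → toℚ ℤ.∣ floor p ∣ ℚ.≤ p × p ℚ.< toℚ (suc ℤ.∣ floor p ∣)
  floor-spec (mkℚ -[1+ _ ] _ _) (*≤* ())
  floor-spec p@(mkℚ (+ n) d-1 _) _ =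
    subst (λ q → toℚ q ℚ.≤ p × p ℚ.< toℚ (suc q))
          (sym (cong ℤ.∣_∣ (ℤ.div-pos-is-/ℕ (+ n) d))) (q≤p , p<1+q)
    where
    d : ℕ
    d = suc d-1
    q≤p : toℚ (n / d) ℚ.≤ p
    q≤p rewrite toℚ≡mkℚ (n / d) =
      *≤* (subst₂ ℤ._≤_ (ℤ.pos-* (n / d) d) (ℤ.pos-* n 1)
                  (ℤ.+≤+ (≤-trans (m/n*n≤m n d) (≤-reflexive (sym (*-identityʳ n))))))
    p<1+q : p ℚ.< toℚ (suc (n / d))
    p<1+q rewrite toℚ≡mkℚ (suc (n / d)) =
      *<* (subst₂ ℤ._<_ (ℤ.pos-* n 1) (ℤ.pos-* (suc (n / d)) d) (ℤ.+<+ (begin-strict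
        n * 1             ≡⟨ *-identityʳ n ⟩
        n                 ≡⟨ m≡m%n+[m/n]*n n d ⟩
        n % d + n / d * d <⟨ +-monoˡ-< (n / d * d) (m%n<n n d) ⟩
        d + n / d * d     ∎)))
      where open ≤-Reasoning

  ≤-floor : ∀ {p} s → 0ℚ ℚ.≤ p → toℚ s ℚ.≤ p → s ≤ ℤ.∣ floor p ∣
  ≤-floor s 0≤p s≤p = ≤-pred (toℚ-cancel-< (ℚ.≤-<-trans s≤p (proj₂ (floor-spec _ 0≤p))))

  floor-< : ∀ {p} s → 0ℚ ℚ.≤ p → p ℚ.< toℚ s → ℤ.∣ floor p ∣ < s
  floor-< s 0≤p p<s = toℚ-cancel-< (ℚ.≤-<-trans (proj₁ (floor-spec _ 0≤p)) p<s)

  *-mono-≤-nonNeg : ∀ {p q r s} → 0ℚ ℚ.≤ p → 0ℚ ℚ.≤ r → p ℚ.≤ q → r ℚ.≤ s →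
                    p ℚ.* r ℚ.≤ q ℚ.* s
  *-mono-≤-nonNeg {p} {q} {r} {s} 0≤p 0≤r p≤q r≤s =
    ℚ.≤-trans (ℚ.*-monoʳ-≤-nonNeg r {{ℚ.nonNegative 0≤r}} p≤q)
              (ℚ.*-monoˡ-≤-nonNeg q {{ℚ.nonNegative (ℚ.≤-trans 0≤p p≤q)}} r≤s)

  ^ℚ-nonNeg : ∀ {p} e → 0ℚ ℚ.≤ p → 0ℚ ℚ.≤ p ^ℚ e
  ^ℚ-nonNeg zero    _   = toℚ-nonNeg 1
  ^ℚ-nonNeg (suc e) 0≤p = *-mono-≤-nonNeg ℚ.≤-refl ℚ.≤-refl 0≤p (^ℚ-nonNeg e 0≤p)

  ^ℚ-mono-≤ : ∀ {p q} e → 0ℚ ℚ.≤ p → p ℚ.≤ q → p ^ℚ e ℚ.≤ q ^ℚ e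
  ^ℚ-mono-≤ zero    _   _   = ℚ.≤-refl
  ^ℚ-mono-≤ (suc e) 0≤p p≤q = *-mono-≤-nonNeg 0≤p (^ℚ-nonNeg e 0≤p) p≤q (^ℚ-mono-≤ e 0≤p p≤q)

  toℚ-^-≤ : ∀ N C z e {Z} → N ^ e ≤ C ^ e * z → toℚ z ℚ.≤ Z → toℚ N ^ℚ e ℚ.≤ toℚ C ^ℚ e ℚ.* Z
  toℚ-^-≤ N C z e {Z} N^e≤ z≤Z = begin
    toℚ N ^ℚ e            ≡⟨ toℚ-^ N e ⟨
    toℚ (N ^ e)           ≤⟨ toℚ-mono-≤ N^e≤ ⟩
    toℚ (C ^ e * z)       ≡⟨ trans (toℚ-* (C ^ e) z) (cong (ℚ._* toℚ z) (toℚ-^ C e)) ⟩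
    toℚ C ^ℚ e ℚ.* toℚ z  ≤⟨ *-mono-≤-nonNeg (^ℚ-nonNeg e (toℚ-nonNeg C)) (toℚ-nonNeg z) ℚ.≤-refl z≤Z ⟩
    toℚ C ^ℚ e ℚ.* Z      ∎
    where open ℚ.≤-Reasoning

  toℚ-^-*-^-≤ : ∀ N w C m z e f {W M Z} → N ^ e * w ^ e ≤ (C * m) ^ e * z ^ f →
                0ℚ ℚ.≤ W → W ℚ.≤ toℚ w → toℚ m ℚ.≤ M → toℚ z ℚ.≤ Z →
                toℚ N ^ℚ e ℚ.* W ^ℚ e ℚ.≤ (toℚ C ℚ.* M) ^ℚ e ℚ.* Z ^ℚ f
  toℚ-^-*-^-≤ N w C m z e f {W} {M} {Z} ≤ℕ 0≤W W≤w m≤M z≤Z = begin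
    toℚ N ^ℚ e ℚ.* W ^ℚ e
      ≤⟨ *-mono-≤-nonNeg (^ℚ-nonNeg e (toℚ-nonNeg N)) (^ℚ-nonNeg e 0≤W) ℚ.≤-refl (^ℚ-mono-≤ e 0≤W W≤w) ⟩
    toℚ N ^ℚ e ℚ.* toℚ w ^ℚ e
      ≡⟨ toℚ-^-*-^ N e w e ⟨
    toℚ (N ^ e * w ^ e)
      ≤⟨ toℚ-mono-≤ ≤ℕ ⟩
    toℚ ((C * m) ^ e * z ^ f)
      ≡⟨ trans (toℚ-^-*-^ (C * m) e z f) (cong (λ q → q ^ℚ e ℚ.* toℚ z ^ℚ f) (toℚ-* C m)) ⟩
    (toℚ C ℚ.* toℚ m) ^ℚ e ℚ.* toℚ z ^ℚ f
      ≤⟨ *-mono-≤-nonNeg (^ℚ-nonNeg e 0≤Cm) (^ℚ-nonNeg f (toℚ-nonNeg z))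
                         (^ℚ-mono-≤ e 0≤Cm Cm≤CM) (^ℚ-mono-≤ f (toℚ-nonNeg z) z≤Z) ⟩
    (toℚ C ℚ.* M) ^ℚ e ℚ.* Z ^ℚ f ∎
    where
    open ℚ.≤-Reasoning
    toℚ-^-*-^ : ∀ a e b f → toℚ (a ^ e * b ^ f) ≡ toℚ a ^ℚ e ℚ.* toℚ b ^ℚ f
    toℚ-^-*-^ a e b f = trans (toℚ-* (a ^ e) (b ^ f)) (cong₂ ℚ._*_ (toℚ-^ a e) (toℚ-^ b f))
    0≤Cm : 0ℚ ℚ.≤ toℚ C ℚ.* toℚ m
    0≤Cm = subst (0ℚ ℚ.≤_) (toℚ-* C m) (toℚ-nonNeg (C * m))
    Cm≤CM : toℚ C ℚ.* toℚ m ℚ.≤ toℚ C ℚ.* M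
    Cm≤CM = *-mono-≤-nonNeg (toℚ-nonNeg C) (toℚ-nonNeg m) ℚ.≤-refl m≤M

  count≤∑rowCount : ∀ k l {X H} → 0ℚ ℚ.≤ X → 0ℚ ℚ.≤ X ℚ.+ H →
    let x = ℤ.∣ floor X ∣ ; y = ℤ.∣ floor (X ℚ.+ H) ∣ in
    count (suc k) (suc l) X H ≤ ∑[ n ∈ oneTo y ] (root k (y ∸ n ^ suc l) ∸ root k (x ∸ n ^ suc l))
  count≤∑rowCount k l {X} {H} 0≤X 0≤X+H = begin
    count (suc k) (suc l) X H
      ≡⟨ length-filter-cartesianProduct (inWindow? (suc k) (suc l) X H) (oneTo y) (oneTo y) ⟩
    ∑[ n ∈ oneTo y ] ∑[ m ∈ oneTo y ] 𝟙 (inWindow? (suc k) (suc l) X H (m , n))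
      ≤⟨ ∑-mono-≤ (oneTo y) column ⟩
    ∑[ n ∈ oneTo y ] (root k (y ∸ n ^ suc l) ∸ root k (x ∸ n ^ suc l)) ∎
    where
    open ≤-Reasoning
    x y : ℕ
    x = ℤ.∣ floor X ∣
    y = ℤ.∣ floor (X ℚ.+ H) ∣
    column : ∀ n → ∑[ m ∈ oneTo y ] 𝟙 (inWindow? (suc k) (suc l) X H (m , n))
                   ≤ root k (y ∸ n ^ suc l) ∸ root k (x ∸ n ^ suc l)
    column n = ∑𝟙-oneTo-≤ (λ m → inWindow? (suc k) (suc l) X H (m , n))
                 (λ 0<m (X<s , s≤X+H) → window⇒root-bounds k 0<m (floor-< _ 0≤X X<s) (≤-floor _ 0≤X+H s≤X+H)) y

  module CountBound (k l : ℕ) {X H : ℚ} (4≤H : toℚ 4 ℚ.≤ H) (H≤X : H ℚ.≤ X) where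

    x η h : ℕ
    x = ℤ.∣ floor X ∣
    η = ℤ.∣ floor H ∣
    h = ℤ.∣ floor (X ℚ.+ H) ∣ ∸ x

    open RowCounts k l x h using (a; b; c; rowSum-bound)

    N : ℕ
    N = count (suc k) (suc l) X H

    0≤H : 0ℚ ℚ.≤ H
    0≤H = ℚ.≤-trans (toℚ-nonNeg 4) 4≤H

    0≤X : 0ℚ ℚ.≤ X
    0≤X = ℚ.≤-trans 0≤H H≤X

    X≤X+H : X ℚ.≤ X ℚ.+ H
    X≤X+H = subst (ℚ._≤ X ℚ.+ H) (ℚ.+-identityʳ X) (ℚ.+-monoʳ-≤ X 0≤H)

    0≤X+H : 0ℚ ℚ.≤ X ℚ.+ H
    0≤X+H = ℚ.≤-trans 0≤X X≤X+H

    x≤X : toℚ x ℚ.≤ X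
    x≤X = proj₁ (floor-spec X 0≤X)

    η≤H : toℚ η ℚ.≤ H
    η≤H = proj₁ (floor-spec H 0≤H)

    1≤η : 1 ≤ η
    1≤η = ≤-trans (s≤s z≤n) (≤-floor 4 0≤H 4≤H)

    η≤x : η ≤ x
    η≤x = ≤-floor η 0≤X (ℚ.≤-trans η≤H H≤X)

    1≤x : 1 ≤ x
    1≤x = ≤-trans 1≤η η≤x

    x+h≡⌊X+H⌋ : x + h ≡ ℤ.∣ floor (X ℚ.+ H) ∣
    x+h≡⌊X+H⌋ = m+[n∸m]≡n (≤-floor x 0≤X+H (ℚ.≤-trans x≤X X≤X+H))

    h≤2η : h ≤ 2 * η
    h≤2η = ≤-trans (m≤n+o⇒m∸n≤o _ x (≤-pred ⌊X+H⌋<)) (1+n≤2*n 1≤η)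
      where
      ⌊X+H⌋< : ℤ.∣ floor (X ℚ.+ H) ∣ < suc x + suc η
      ⌊X+H⌋< = floor-< (suc x + suc η) 0≤X+H
                 (subst (X ℚ.+ H ℚ.<_) (sym (toℚ-+ (suc x) (suc η)))
                        (ℚ.+-mono-< (proj₂ (floor-spec X 0≤X)) (proj₂ (floor-spec H 0≤H))))

    X≤2x : X ℚ.≤ toℚ (2 * x)
    X≤2x = ℚ.<⇒≤ (ℚ.<-≤-trans (proj₂ (floor-spec X 0≤X)) (toℚ-mono-≤ (1+n≤2*n 1≤x)))

    regroup : ∀ j m z → 3 * (j * (m * z)) ≡ 3 * j * m * z
    regroup = solve-∀

    N*x≤ : N * x ≤ 16 * (h * (a * b)) + 2 * (c * x) + 3 * (b * x)
    N*x≤ = ≤-trans (*-monoˡ-≤ x N≤) (rowSum-bound 1≤x (≤-trans h≤2η (*-monoʳ-≤ 2 η≤x)))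
      where
      N≤ : N ≤ ∑[ n ∈ oneTo (x + h) ] RowCounts.rowCount k l x h n
      N≤ = subst (λ y → N ≤ ∑[ n ∈ oneTo y ] (root k (y ∸ n ^ suc l) ∸ root k (x ∸ n ^ suc l)))
                 (sym x+h≡⌊X+H⌋) (count≤∑rowCount k l 0≤X 0≤X+H)

    cancel-x : ∀ {m} → N * x ≤ m * x → N ≤ m
    cancel-x {m} = *-cancelʳ-≤ N m x {{>-nonZero 1≤x}}

    N^L≤ : N * x ≤ 3 * (3 * (b * x)) → toℚ N ^ℚ suc l ℚ.≤ toℚ 192 ^ℚ suc l ℚ.* X
    N^L≤ N*x≤9bx = toℚ-^-≤ N 192 x (suc l) (^-≤-^-* 192 b (suc l) N≤192b (root-^-≤ l x)) x≤X
      where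
      N≤192b : N ≤ 192 * b
      N≤192b = ≤-trans (cancel-x (≤-trans N*x≤9bx (≤-reflexive (regroup 3 b x)))) (*-monoˡ-≤ b (m≤m+n 9 183))

    N^K≤ : N * x ≤ 3 * (2 * (c * x)) → toℚ N ^ℚ suc k ℚ.≤ toℚ 192 ^ℚ suc k ℚ.* H
    N^K≤ N*x≤6cx = toℚ-^-≤ N 192 η (suc k) (begin
      N ^ suc k               ≤⟨ ^-≤-^-* 6 c (suc k) N≤6c (≤-trans (root-^-≤ k h) h≤2η) ⟩
      6 ^ suc k * (2 * η)     ≡⟨ x∙yz≈yx∙z (6 ^ suc k) 2 η ⟩
      2 * 6 ^ suc k * η       ≤⟨ *-monoˡ-≤ η (2*m^k≤[2*m]^k k 6) ⟩
      12 ^ suc k * η          ≤⟨ *-monoˡ-≤ η (^-monoˡ-≤ (suc k) (m≤m+n 12 180)) ⟩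
      192 ^ suc k * η         ∎) η≤H
      where
      open ≤-Reasoning
      N≤6c : N ≤ 6 * c
      N≤6c = cancel-x (≤-trans N*x≤6cx (≤-reflexive (regroup 2 c x)))

    -- 192 = 2 · 2 · 48, the factors 2 coming from X ≤ 2x and h ≤ 2η.
    N^e*X^e≤ : N * x ≤ 3 * (16 * (h * (a * b))) →
               toℚ N ^ℚ (suc k * suc l) ℚ.* X ^ℚ (suc k * suc l)
                 ℚ.≤ (toℚ 192 ℚ.* H) ^ℚ (suc k * suc l) ℚ.* X ^ℚ (suc k + suc l)
    N^e*X^e≤ N*x≤48hab =
      toℚ-^-*-^-≤ N (2 * x) 192 η x (suc k * suc l) (suc k + suc l)
                  (^-*-^-≤ N (2 * x) 192 η a b (suc k) (suc l) N*2x≤ (root-^-≤ k x) (root-^-≤ l x))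
                  0≤X X≤2x η≤H x≤X
      where
      open ≤-Reasoning
      N*2x≤ : N * (2 * x) ≤ 192 * η * (a * b)
      N*2x≤ = begin
        N * (2 * x)                    ≡⟨ x∙yz≈y∙xz N 2 x ⟩
        2 * (N * x)                    ≤⟨ *-monoʳ-≤ 2 N*x≤48hab ⟩
        2 * (3 * (16 * (h * (a * b)))) ≡⟨ ≡96 h (a * b) ⟩
        96 * h * (a * b)               ≤⟨ *-monoˡ-≤ (a * b) (*-monoʳ-≤ 96 h≤2η) ⟩
        96 * (2 * η) * (a * b)         ≡⟨ ≡192 η (a * b) ⟩
        192 * η * (a * b)              ∎
        where
        ≡96 : ∀ u m → 2 * (3 * (16 * (u * m))) ≡ 96 * u * m
        ≡96 = solve-∀
        ≡192 : ∀ u m → 96 * (2 * u) * m ≡ 192 * u * m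
        ≡192 = solve-∀

    dominantTerm : N * x ≤ 3 * (16 * (h * (a * b))) ⊎ N * x ≤ 3 * (2 * (c * x)) ⊎ N * x ≤ 3 * (3 * (b * x))
    dominantTerm = ≤-+-+⇒≤3* (16 * (h * (a * b))) (2 * (c * x)) (3 * (b * x)) N*x≤

open import Defs
open import Data.Nat using (ℕ; _≥_; suc)
open import Data.Rational using (ℚ; _≤_; _*_)
open import Data.Product using (Σ; _,_)
open import Data.Sum using (_⊎_; map)

lemma3p4 : Σ ℕ λ C → (k ℓ : ℕ) → k ≥ 1 → ℓ ≥ 1 → (X H : ℚ) → toℚ 4 ≤ H → H ≤ X →
    ((toℚ (count k ℓ X H)) ^ℚ (k Data.Nat.* ℓ) * X ^ℚ (k Data.Nat.* ℓ)
        ≤ (toℚ C * H) ^ℚ (k Data.Nat.* ℓ) * X ^ℚ (k Data.Nat.+ ℓ))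
    ⊎ ((toℚ (count k ℓ X H)) ^ℚ k ≤ (toℚ C) ^ℚ k * H)
    ⊎ ((toℚ (count k ℓ X H)) ^ℚ ℓ ≤ (toℚ C) ^ℚ ℓ * X)
lemma3p4 = 192 , λ where
  (suc k) (suc l) _ _ X H 4≤H H≤X →
    let open Discretisation.CountBound k l 4≤H H≤X
    in map N^e*X^e≤ (map N^K≤ N^L≤) dominantTerm
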